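{- Let $G$ be a graph of order $n$ which has a Hamiltonian path. Then $z(G;i)\leq\binom{n}{i}-\binom{n-i-1}{i}$ for $1\leq i\leq n$, and this bound is sharp: equality holds for all $1\le i\le n$ when $G$ is the path $P_n$.
   Context: Zero forcing: given a set of colored vertices, a colored vertex $u$ with exactly one uncolored neighbor $v$ may force $v$ to become colored; $S$ is a zero forcing set if starting with $S$ colored and repeatedly applying this rule colors all vertices. $z(G;i)$ is the number of zero forcing sets of size $i$. A Hamiltonian path is a path visiting every vertex exactly once. Convention: $\binom{a}{b}=0$ whenever $a<b$ (including negative $a$). -}

module Defs where

open import Data.Bool using (Bool; true; false; _∧_; _∨_; not; if_then_else_)
open import Data.Nat using (ℕ; zero; suc; _≡ᵇ_)
open import Data.Fin using (Fin; toℕ; _≟_)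
open import Data.Fin.Subset using (Subset)
open import Data.Vec using (Vec; []; _∷_; lookup; tabulate)
open import Data.List using (List; []; _∷_; map; _++_; filter; length; allFin)
open import Data.Bool.ListAction using (all; any)
open import Data.Bool.Properties using (∨-comm)
open import Data.Product using (Σ; _×_)
open import Relation.Binary.PropositionalEquality using (refl)
open import Relation.Nullary.Decidable using (⌊_⌋)
open import Relation.Binary.PropositionalEquality using (_≡_)
open import Function using (_∘_)
open import Function.Definitions using (Injective)

record Graph (n : ℕ) : Set where
  field
    Adj     : Fin n → Fin n → Bool
    symm    : ∀ u v → Adj u v ≡ Adj v u
    irrefl  : ∀ v → Adj v v ≡ false
open Graph public

-- A Hamiltonian path: an ordering σ of all vertices (injective, hence a
-- bijection of Fin n) in which consecutive vertices are adjacent.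
HasHamiltonianPath : ∀ {n} → Graph n → Set
HasHamiltonianPath {n} G =
  Σ (Fin n → Fin n) λ σ →
    Injective _≡_ _≡_ σ ×
    (∀ (i j : Fin n) → toℕ j ≡ suc (toℕ i) → Adj G (σ i) (σ j) ≡ true)

canForce : ∀ {n} → Graph n → Subset n → Fin n → Fin n → Bool
canForce {n} G S u v =
  lookup S u ∧ not (lookup S v) ∧ Adj G u v ∧
  all (λ w → not (Adj G u w) ∨ lookup S w ∨ ⌊ w ≟ v ⌋) (allFin n)

forceStep : ∀ {n} → Graph n → Subset n → Subset n
forceStep {n} G S =
  tabulate λ v → lookup S v ∨ any (λ u → canForce G S u v) (allFin n)

iterate : ∀ {A : Set} → ℕ → (A → A) → A → A
iterate zero    f a = a
iterate (suc k) f a = iterate k f (f a)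

-- The final colored set obtained from S by repeatedly applying the
-- forcing rule (at most n rounds are needed, each round colors at least
-- one new vertex or nothing changes any more).
closure : ∀ {n} → Graph n → Subset n → Subset n
closure {n} G S = iterate n (forceStep G) S

isZeroForcingSet : ∀ {n} → Graph n → Subset n → Bool
isZeroForcingSet {n} G S = all (lookup (closure G S)) (allFin n)

allSubsets : ∀ n → List (Subset n)
allSubsets zero    = [] ∷ []
allSubsets (suc n) = map (false ∷_) (allSubsets n) ++ map (true ∷_) (allSubsets n)

card : ∀ {n} → Subset n → ℕ
card []           = 0
card (true  ∷ s) = suc (card s)
card (false ∷ s) = card s

z : ∀ {n} → Graph n → ℕ → ℕ
z {n} G i =
  length (filter (λ S → Data.Bool.T? (isZeroForcingSet G S ∧ (card S ≡ᵇ i))) (allSubsets n))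
  where import Data.Bool

pathAdj : ∀ {n} → Fin n → Fin n → Bool
pathAdj i j = (toℕ j ≡ᵇ suc (toℕ i)) ∨ (toℕ i ≡ᵇ suc (toℕ j))

private
  ≡ᵇ-suc : ∀ m → (m ≡ᵇ suc m) ≡ false
  ≡ᵇ-suc zero    = refl
  ≡ᵇ-suc (suc m) = ≡ᵇ-suc m

path : ∀ n → Graph n
path n = record
  { Adj    = pathAdj
  ; symm   = λ u v → ∨-comm (toℕ v ≡ᵇ suc (toℕ u)) (toℕ u ≡ᵇ suc (toℕ v))
  ; irrefl = λ v → irr (toℕ v)
  }
  where
    irr : ∀ m → ((m ≡ᵇ suc m) ∨ (m ≡ᵇ suc m)) ≡ false
    irr m rewrite ≡ᵇ-suc m = refl

module Submission where

-- Read a subset S of the vertices along a Hamiltonian path σ as a bit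
-- string.  Call the string *isolated* when its first and last entries are
-- uncolored and no two consecutive entries are colored.  Then every colored
-- vertex has two distinct uncolored neighbours on the path, so no force is
-- ever possible and S is not a zero forcing set.  Isolated strings of length
-- n with i colored entries are counted by C(n-i-1, i); relabelling along σ
-- injects them into the non-forcing sets of G, which gives
--   z(G;i) ≤ C(n,i) - C(n-i-1,i).
-- For the path P_n the converse holds: a non-isolated set contains a colored
-- block (an endpoint, or two adjacent vertices, ...) that grows by one vertex
-- in every forcing round until it covers the path, so equality holds.

open import Defs
open import Data.Bool using (Bool; true; false; _∧_; _∨_; not; T; T?)
open import Data.Bool.Properties using (∧-conicalˡ; ∧-conicalʳ; ∧-zeroʳ; ∨-zeroʳ; ∨-identityʳ; ¬-not; T-≡)
  renaming (_≟_ to _≟ᵇ_)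
open import Data.Bool.ListAction using (all; any)
open import Data.Nat using (ℕ; zero; suc; _+_; _∸_; _≤_; _<_; z≤n; s≤s; s≤s⁻¹; _≡ᵇ_)
open import Data.Nat.Properties hiding (_≟_)
open import Data.Nat.Combinatorics using (_C_; nCk+nC[k+1]≡[n+1]C[k+1])
open import Data.Fin using (Fin; toℕ; fromℕ<; _≟_; punchOut)
open import Data.Fin.Properties using (toℕ-fromℕ<; toℕ-injective; toℕ<n; any?; injective⇒≤; punchOut-injective)
open import Data.Fin.Subset using (Subset)
open import Data.Vec using (Vec; []; _∷_; lookup; tabulate)
open import Data.Vec.Properties using (lookup∘tabulate; tabulate∘lookup; tabulate-cong; ≡-dec)
open import Data.List using (List; []; _∷_; map; _++_; filter; length; allFin)
import Data.List as List
open import Data.List.Properties using (length-map)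
open import Data.List.Membership.Propositional using (_∈_)
open import Data.List.Membership.Propositional.Properties using (∈-map⁺; ∈-map⁻; ∈-++⁺ˡ; ∈-++⁺ʳ; ∈-filter⁺; ∈-filter⁻; ∈-allFin)
open import Data.List.Relation.Unary.Any using (here; there)
import Data.List.Relation.Unary.Any as Any
import Data.List.Relation.Unary.All as All
import Data.List.Relation.Unary.AllPairs as AllPairs
open import Data.List.Relation.Unary.All.Properties using (all⁺; all⁻)
open import Data.List.Relation.Unary.Any.Properties using (any⁺; any⁻)
open import Data.List.Relation.Unary.Unique.Propositional using (Unique)
import Data.List.Relation.Unary.Unique.Propositional.Properties as Unique
open import Data.Product using (Σ; _×_; _,_; proj₁; proj₂; map₁)
open import Data.Sum using (_⊎_; inj₁; inj₂; map₂)
open import Data.Empty using (⊥; ⊥-elim)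
open import Function using (_∘_)
open import Function.Bundles using (Equivalence)
open import Function.Definitions using (Injective)
open import Relation.Binary.Definitions using (DecidableEquality)
open import Relation.Binary.PropositionalEquality
open import Relation.Nullary using (Dec; yes; no)
open import Relation.Nullary.Decidable using (⌊_⌋)

T⇒≡true : ∀ {b} → T b → b ≡ true
T⇒≡true {b} = Equivalence.to (T-≡ {b})

≡true⇒T : ∀ {b} → b ≡ true → T b
≡true⇒T {b} = Equivalence.from (T-≡ {b})

true≢false : true ≢ false
true≢false ()

count : {A : Set} → (A → Bool) → List A → ℕ
count p xs = length (filter (λ x → T? (p x)) xs)

module _ {A : Set} where

  count-mono : (p q : A → Bool) → (∀ x → p x ≡ true → q x ≡ true) →
               ∀ xs → count p xs ≤ count q xs
  count-mono p q p⇒q [] = z≤n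
  count-mono p q p⇒q (x ∷ xs) with p x in px | q x in qx
  ... | false | false = count-mono p q p⇒q xs
  ... | false | true  = m≤n⇒m≤1+n (count-mono p q p⇒q xs)
  ... | true  | false with () ← trans (sym (p⇒q x px)) qx
  ... | true  | true  = s≤s (count-mono p q p⇒q xs)

  count-cong : (p q : A → Bool) → (∀ x → p x ≡ q x) → ∀ xs → count p xs ≡ count q xs
  count-cong p q p≡q xs =
    ≤-antisym (count-mono p q (λ x e → trans (sym (p≡q x)) e) xs)
              (count-mono q p (λ x e → trans (p≡q x) e) xs)

  count-split : (p q : A → Bool) → ∀ xs →
    count (λ x → p x ∧ q x) xs + count (λ x → not (p x) ∧ q x) xs ≡ count q xs
  count-split p q [] = refl
  count-split p q (x ∷ xs) with p x | q x
  ... | true  | true  = cong suc (count-split p q xs)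
  ... | false | true  = trans (+-suc _ _) (cong suc (count-split p q xs))
  ... | true  | false = count-split p q xs
  ... | false | false = count-split p q xs

  count-none : (p : A → Bool) → (∀ x → p x ≡ false) → ∀ xs → count p xs ≡ 0
  count-none p none [] = refl
  count-none p none (x ∷ xs) rewrite none x = count-none p none xs

  count-++ : (p : A → Bool) → ∀ xs ys → count p (xs ++ ys) ≡ count p xs + count p ys
  count-++ p [] ys = refl
  count-++ p (x ∷ xs) ys with p x
  ... | true  = cong suc (count-++ p xs ys)
  ... | false = count-++ p xs ys

  count-map : {B : Set} (p : A → Bool) (f : B → A) → ∀ xs →
              count p (map f xs) ≡ count (p ∘ f) xs
  count-map p f [] = refl
  count-map p f (x ∷ xs) with p (f x)
  ... | true  = cong suc (count-map p f xs)
  ... | false = count-map p f xs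

module _ {A : Set} (_≟ᴬ_ : DecidableEquality A) where

  private
    remove : A → List A → List A
    remove x [] = []
    remove x (y ∷ ys) with x ≟ᴬ y
    ... | yes _ = ys
    ... | no  _ = y ∷ remove x ys

    length-remove : ∀ {x} ys → x ∈ ys → suc (length (remove x ys)) ≡ length ys
    length-remove {x} (y ∷ ys) x∈ with x ≟ᴬ y
    length-remove (y ∷ ys) _           | yes _ = refl
    length-remove (y ∷ ys) (here refl) | no x≢y = ⊥-elim (x≢y refl)
    length-remove (y ∷ ys) (there x∈)  | no _   = cong suc (length-remove ys x∈)

    ∈-remove : ∀ {x w} ys → w ∈ ys → w ≢ x → w ∈ remove x ys
    ∈-remove {x} (y ∷ ys) w∈ w≢x with x ≟ᴬ y
    ∈-remove (y ∷ ys) (here refl) w≢x | yes refl = ⊥-elim (w≢x refl)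
    ∈-remove (y ∷ ys) (there w∈)  w≢x | yes refl = w∈
    ∈-remove (y ∷ ys) (here refl) w≢x | no _     = here refl
    ∈-remove (y ∷ ys) (there w∈)  w≢x | no _     = there (∈-remove ys w∈ w≢x)

  unique-⊆⇒length≤ : ∀ xs ys → Unique xs → (∀ {w} → w ∈ xs → w ∈ ys) → length xs ≤ length ys
  unique-⊆⇒length≤ [] ys _ _ = z≤n
  unique-⊆⇒length≤ (x ∷ xs) ys (x∉xs AllPairs.∷ uxs) xs⊆ys =
    subst (suc (length xs) ≤_) (length-remove ys (xs⊆ys (here refl)))
      (s≤s (unique-⊆⇒length≤ xs (remove x ys) uxs
        (λ w∈ → ∈-remove ys (xs⊆ys (there w∈)) (λ w≡x → All.lookup x∉xs w∈ (sym w≡x)))))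

  count-injection : (xs ys : List A) → Unique xs → (∀ y → y ∈ ys) →
    (p q : A → Bool) (h : A → A) → Injective _≡_ _≡_ h →
    (∀ x → p x ≡ true → q (h x) ≡ true) → count p xs ≤ count q ys
  count-injection xs ys uxs complete p q h h-inj p⇒qh =
    subst (_≤ count q ys) (length-map h (filter (T? ∘ p) xs))
      (unique-⊆⇒length≤ (map h (filter (T? ∘ p) xs)) (filter (T? ∘ q) ys)
        (Unique.map⁺ h-inj (Unique.filter⁺ (T? ∘ p) uxs)) image⊆)
    where
    image⊆ : ∀ {w} → w ∈ map h (filter (T? ∘ p) xs) → w ∈ filter (T? ∘ q) ys
    image⊆ w∈ with ∈-map⁻ h w∈
    ... | x , x∈ , refl =
      ∈-filter⁺ (T? ∘ q) (complete (h x))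
        (≡true⇒T (p⇒qh x (T⇒≡true (proj₂ (∈-filter⁻ (T? ∘ p) {xs = xs} x∈)))))

countSubsets : ∀ {n} → (Subset n → Bool) → ℕ
countSubsets {n} p = count p (allSubsets n)

countSubsets-suc : ∀ {n} (p : Subset (suc n) → Bool) →
  countSubsets p ≡ countSubsets (λ s → p (false ∷ s)) + countSubsets (λ s → p (true ∷ s))
countSubsets-suc {n} p =
  trans (count-++ p (map (false ∷_) (allSubsets n)) (map (true ∷_) (allSubsets n)))
        (cong₂ _+_ (count-map p (false ∷_) (allSubsets n)) (count-map p (true ∷_) (allSubsets n)))

allSubsets-complete : ∀ {n} (s : Subset n) → s ∈ allSubsets n
allSubsets-complete []          = here refl
allSubsets-complete {suc n} (false ∷ s) = ∈-++⁺ˡ (∈-map⁺ (false ∷_) (allSubsets-complete s))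
allSubsets-complete {suc n} (true ∷ s)  =
  ∈-++⁺ʳ (map (false ∷_) (allSubsets n)) (∈-map⁺ (true ∷_) (allSubsets-complete s))

allSubsets-unique : ∀ n → Unique (allSubsets n)
allSubsets-unique zero    = All.[] AllPairs.∷ AllPairs.[]
allSubsets-unique (suc n) =
  Unique.++⁺ (Unique.map⁺ ∷-injective (allSubsets-unique n))
             (Unique.map⁺ ∷-injective (allSubsets-unique n)) disjoint
  where
  ∷-injective : ∀ {b} {s t : Subset n} → b ∷ s ≡ b ∷ t → s ≡ t
  ∷-injective refl = refl
  disjoint : ∀ {s} → s ∈ map (false ∷_) (allSubsets n) × s ∈ map (true ∷_) (allSubsets n) → ⊥
  disjoint (s∈₀ , s∈₁) with ∈-map⁻ (false ∷_) s∈₀ | ∈-map⁻ (true ∷_) s∈₁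
  ... | _ , _ , refl | _ , _ , ()

countSubsets-card : ∀ n i → countSubsets {n} (λ s → card s ≡ᵇ i) ≡ n C i
countSubsets-card zero    zero    = refl
countSubsets-card zero    (suc i) = refl
countSubsets-card (suc n) i = trans (countSubsets-suc {n} (λ s → card s ≡ᵇ i)) (pascal i)
  where
  pascal : ∀ i → countSubsets {n} (λ s → card s ≡ᵇ i) + countSubsets {n} (λ s → suc (card s) ≡ᵇ i)
                 ≡ suc n C i
  pascal zero    = trans (cong₂ _+_ (countSubsets-card n 0) (count-none _ (λ _ → refl) (allSubsets n))) refl
  pascal (suc i) = trans (cong₂ _+_ (countSubsets-card n (suc i)) (countSubsets-card n i))
                         (trans (+-comm (n C suc i) (n C i)) (nCk+nC[k+1]≡[n+1]C[k+1] n i))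

countSubsets-complement : ∀ {n} (bad : Subset n → Bool) i →
  countSubsets (λ s → not (bad s) ∧ (card s ≡ᵇ i))
    ≡ n C i ∸ countSubsets (λ s → bad s ∧ (card s ≡ᵇ i))
countSubsets-complement {n} bad i = begin
  good                 ≡⟨ sym (m+n∸m≡n bad# good) ⟩
  bad# + good ∸ bad#   ≡⟨ cong (_∸ bad#) (trans (count-split bad (λ s → card s ≡ᵇ i) (allSubsets n))
                                                (countSubsets-card n i)) ⟩
  n C i ∸ bad#         ∎
  where
  open ≡-Reasoning
  bad#  = countSubsets (λ s → bad s ∧ (card s ≡ᵇ i))
  good  = countSubsets (λ s → not (bad s) ∧ (card s ≡ᵇ i))

-- Read s : Vec Bool m as s₀ s₁ … s_{m-1} (true = colored):
--   startsFree s : s₀ is uncolored (false for the empty string);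
--   spaced s     : every colored entry is followed by an uncolored entry,
--                  so no two colored entries are consecutive and the last
--                  entry is uncolored;
--   isolated s   : both, i.e. every colored entry lies strictly inside the
--                  string with uncolored entries on either side.
startsFree : ∀ {m} → Vec Bool m → Bool
startsFree []      = false
startsFree (b ∷ s) = not b

spaced : ∀ {m} → Vec Bool m → Bool
spaced []          = true
spaced (false ∷ s) = spaced s
spaced (true ∷ s)  = startsFree s ∧ spaced s

isolated : ∀ {m} → Vec Bool m → Bool
isolated s = startsFree s ∧ spaced s

spacedCount : ℕ → ℕ → ℕ
spacedCount m k = countSubsets {m} (λ s → spaced s ∧ (card s ≡ᵇ k))

isolatedCount : ℕ → ℕ → ℕ
isolatedCount m k = countSubsets {m} (λ s → isolated s ∧ (card s ≡ᵇ k))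

isolatedCount-suc : ∀ m k → isolatedCount (suc m) k ≡ spacedCount m k
isolatedCount-suc m k =
  trans (countSubsets-suc {m} (λ s → isolated s ∧ (card s ≡ᵇ k)))
        (trans (cong (spacedCount m k +_) (count-none _ (λ _ → refl) (allSubsets m)))
               (+-identityʳ _))

spacedCount-suc : ∀ m k → spacedCount (suc m) k
  ≡ spacedCount m k + countSubsets {m} (λ s → isolated s ∧ (suc (card s) ≡ᵇ k))
spacedCount-suc m k = countSubsets-suc {m} (λ s → spaced s ∧ (card s ≡ᵇ k))

-- Pascal's rule in the form needed below (both sides vanish when k > m).
pascal-∸ : ∀ m k → (m ∸ k) C suc k + (m ∸ k) C k ≡ (suc m ∸ k) C suc k
pascal-∸ m k with k ≤? m
... | yes k≤m rewrite +-∸-assoc 1 k≤m =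
  trans (+-comm ((m ∸ k) C suc k) _) (nCk+nC[k+1]≡[n+1]C[k+1] (m ∸ k) k)
pascal-∸ m zero    | no 0≰m = ⊥-elim (0≰m z≤n)
pascal-∸ m (suc k) | no k≰m
  rewrite m≤n⇒m∸n≡0 (<⇒≤ (≰⇒> k≰m)) | m≤n⇒m∸n≡0 (≰⇒> k≰m) = refl

-- There are C(m-k, k) spaced strings of length m with k colored entries:
-- glue each colored entry to the uncolored entry after it.
spacedCount≡ : ∀ m k → spacedCount m k ≡ (m ∸ k) C k
spacedCount≡ zero          zero    = refl
spacedCount≡ zero          (suc k) = refl
spacedCount≡ (suc m)       zero    = begin
  spacedCount (suc m) 0
    ≡⟨ spacedCount-suc m 0 ⟩
  spacedCount m 0 + countSubsets {m} (λ s → isolated s ∧ (suc (card s) ≡ᵇ 0))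
    ≡⟨ cong (spacedCount m 0 +_) (count-none _ (λ s → ∧-zeroʳ (isolated s)) (allSubsets m)) ⟩
  spacedCount m 0 + 0
    ≡⟨ trans (+-identityʳ _) (spacedCount≡ m 0) ⟩
  suc m C 0
    ∎
  where open ≡-Reasoning
spacedCount≡ (suc zero)    (suc k) rewrite 0∸n≡0 k = refl
spacedCount≡ (suc (suc m)) (suc k) = begin
  spacedCount (suc (suc m)) (suc k)
    ≡⟨ spacedCount-suc (suc m) (suc k) ⟩
  spacedCount (suc m) (suc k) + isolatedCount (suc m) k
    ≡⟨ cong₂ _+_ (spacedCount≡ (suc m) (suc k)) (trans (isolatedCount-suc m k) (spacedCount≡ m k)) ⟩
  (m ∸ k) C suc k + (m ∸ k) C k
    ≡⟨ pascal-∸ m k ⟩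
  (suc m ∸ k) C suc k
    ∎
  where open ≡-Reasoning

isolatedCount≡ : ∀ m i → isolatedCount (suc m) i ≡ (suc m ∸ i ∸ 1) C i
isolatedCount≡ m i = begin
  isolatedCount (suc m) i  ≡⟨ isolatedCount-suc m i ⟩
  spacedCount m i          ≡⟨ spacedCount≡ m i ⟩
  (m ∸ i) C i              ≡⟨ cong (_C i) (sym (trans (∸-+-assoc (suc m) i 1) (cong (suc m ∸_) (+-comm i 1)))) ⟩
  (suc m ∸ i ∸ 1) C i      ∎
  where open ≡-Reasoning

-- The entry of a bit string at position x (uncolored beyond the end).
at : ∀ {m} → Vec Bool m → ℕ → Bool
at []      x       = false
at (b ∷ s) zero    = b
at (b ∷ s) (suc x) = at s x

lookup≡at : ∀ {m} (s : Vec Bool m) (v : Fin m) → lookup s v ≡ at s (toℕ v)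
lookup≡at (b ∷ s) Fin.zero    = refl
lookup≡at (b ∷ s) (Fin.suc v) = lookup≡at s v

at-fromℕ< : ∀ {m} (s : Vec Bool m) {x} (x<m : x < m) → at s x ≡ lookup s (fromℕ< x<m)
at-fromℕ< s x<m = trans (cong (at s) (sym (toℕ-fromℕ< x<m))) (sym (lookup≡at s (fromℕ< x<m)))

at⇒< : ∀ {m} (s : Vec Bool m) x → at s x ≡ true → x < m
at⇒< (b ∷ s) zero    _       = s≤s z≤n
at⇒< (b ∷ s) (suc x) colored = s≤s (at⇒< s x colored)

spaced-next : ∀ {m} (s : Vec Bool m) x → spaced s ≡ true → at s x ≡ true →
              suc x < m × at s (suc x) ≡ false
spaced-next (true ∷ [])          zero    ()      _
spaced-next (true ∷ (true ∷ s))  zero    ()      _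
spaced-next (true ∷ (false ∷ s)) zero    _       _       = s≤s (s≤s z≤n) , refl
spaced-next (false ∷ s)          (suc x) sp      colored = map₁ s≤s (spaced-next s x sp colored)
spaced-next (true ∷ s)           (suc x) sp      colored =
  map₁ s≤s (spaced-next s x (∧-conicalʳ (startsFree s) _ sp) colored)

record Isolation {m} (s : Vec Bool m) (x : ℕ) : Set where
  field
    prev      : ℕ
    x≡1+prev  : x ≡ suc prev
    1+x<m     : suc x < m
    prev-free : at s prev ≡ false
    next-free : at s (suc x) ≡ false

isolated-isolation : ∀ {m} (s : Vec Bool m) x → isolated s ≡ true → at s x ≡ true → Isolation s x
isolated-isolation (true ∷ s)  zero ()  _
isolated-isolation (false ∷ s) zero _   ()
isolated-isolation s (suc p) iso colored = record
  { prev      = p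
  ; x≡1+prev  = refl
  ; 1+x<m     = proj₁ next
  ; prev-free = prev-free
  ; next-free = proj₂ next
  }
  where
  sp = ∧-conicalʳ (startsFree s) _ iso
  next = spaced-next s (suc p) sp colored
  prev-free : at s p ≡ false
  prev-free = ¬-not λ p-colored → true≢false (trans (sym colored) (proj₂ (spaced-next s p sp p-colored)))

isolated-firstFree : ∀ {m} (s : Vec Bool m) → isolated s ≡ true → Σ (Fin m) λ v → lookup s v ≡ false
isolated-firstFree (false ∷ s) _ = Fin.zero , refl
isolated-firstFree (true ∷ s)  ()

spaced-failure : ∀ {m} (s : Vec Bool m) → spaced s ≡ false →
  Σ ℕ λ x → at s x ≡ true × (suc x ≡ m ⊎ at s (suc x) ≡ true)
spaced-failure (false ∷ s) fail with spaced-failure s fail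
... | x , colored , inj₁ last = suc x , colored , inj₁ (cong suc last)
... | x , colored , inj₂ next = suc x , colored , inj₂ next
spaced-failure (true ∷ [])          _    = 0 , refl , inj₁ refl
spaced-failure (true ∷ (true ∷ s))  _    = 0 , refl , inj₂ refl
spaced-failure (true ∷ (false ∷ s)) fail with spaced-failure s fail
... | x , colored , inj₁ last = suc (suc x) , colored , inj₁ (cong (suc ∘ suc) last)
... | x , colored , inj₂ next = suc (suc x) , colored , inj₂ next

isolated-failure : ∀ {m} (s : Vec Bool (suc m)) → isolated s ≡ false →
  at s 0 ≡ true ⊎ Σ ℕ λ x → at s x ≡ true × (suc x ≡ suc m ⊎ at s (suc x) ≡ true)
isolated-failure (true ∷ s)  _    = inj₁ refl
isolated-failure (false ∷ s) fail = inj₂ (spaced-failure (false ∷ s) fail)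

module _ {A : Set} (p : A → Bool) where

  all-true : ∀ {x} xs → all p xs ≡ true → x ∈ xs → p x ≡ true
  all-true xs all≡ x∈ = T⇒≡true (All.lookup (all⁺ p xs (≡true⇒T all≡)) x∈)

  all-intro : (∀ x → p x ≡ true) → ∀ xs → all p xs ≡ true
  all-intro every xs = T⇒≡true (all⁻ p (All.universal (λ x → ≡true⇒T (every x)) xs))

  any-intro : ∀ {x} xs → x ∈ xs → p x ≡ true → any p xs ≡ true
  any-intro xs x∈ px = T⇒≡true (any⁺ p (Any.map (λ { refl → ≡true⇒T px }) x∈))

  any-none : (∀ x → p x ≡ false) → ∀ xs → any p xs ≡ false
  any-none none xs = ¬-not λ any≡ →
    let (x , px) = Any.satisfied (any⁻ p xs (≡true⇒T any≡)) in subst T (none x) px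

dec-true : ∀ {P : Set} (d : Dec P) → ⌊ d ⌋ ≡ true → P
dec-true (yes p) _ = p

forceStep-lookup : ∀ {n} (G : Graph n) (S : Subset n) v →
  lookup (forceStep G S) v ≡ (lookup S v ∨ any (λ u → canForce G S u v) (allFin n))
forceStep-lookup G S v = lookup∘tabulate _ v

forceStep-keeps : ∀ {n} (G : Graph n) (S : Subset n) v →
  lookup S v ≡ true → lookup (forceStep G S) v ≡ true
forceStep-keeps G S v colored rewrite forceStep-lookup G S v | colored = refl

forceStep-keeps-at : ∀ {n} (G : Graph n) (S : Subset n) x → at S x ≡ true → at (forceStep G S) x ≡ true
forceStep-keeps-at G S x colored =
  trans (at-fromℕ< (forceStep G S) x<n) (forceStep-keeps G S _ (trans (sym (at-fromℕ< S x<n)) colored))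
  where x<n = at⇒< S x colored

forceStep-forces : ∀ {n} (G : Graph n) (S : Subset n) u v →
  canForce G S u v ≡ true → lookup (forceStep G S) v ≡ true
forceStep-forces {n} G S u v force
  rewrite forceStep-lookup G S v | any-intro (λ u → canForce G S u v) (allFin n) (∈-allFin u) force =
  ∨-zeroʳ _

canForce-intro : ∀ {n} (G : Graph n) (S : Subset n) u v →
  lookup S u ≡ true → lookup S v ≡ false → Adj G u v ≡ true →
  (∀ w → Adj G u w ≡ true → w ≢ v → lookup S w ≡ true) → canForce G S u v ≡ true
canForce-intro {n} G S u v u∈S v∉S uv others rewrite u∈S | v∉S | uv = all-intro _ only-v (allFin n)
  where
  only-v : ∀ w → (not (Adj G u w) ∨ lookup S w ∨ ⌊ w ≟ v ⌋) ≡ true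
  only-v w with Adj G u w in uw | w ≟ v
  ... | false | _      = refl
  ... | true  | yes _  = ∨-zeroʳ _
  ... | true  | no w≢v rewrite others w uw w≢v = refl

record Blocked {n} (G : Graph n) (S : Subset n) (u : Fin n) : Set where
  field
    w₁ w₂       : Fin n
    distinct    : w₁ ≢ w₂
    adjacent₁   : Adj G u w₁ ≡ true
    adjacent₂   : Adj G u w₂ ≡ true
    uncolored₁  : lookup S w₁ ≡ false
    uncolored₂  : lookup S w₂ ≡ false

Stalled : ∀ {n} → Graph n → Subset n → Set
Stalled G S = ∀ u → lookup S u ≡ true → Blocked G S u

stalled⇒cannotForce : ∀ {n} (G : Graph n) (S : Subset n) → Stalled G S →
  ∀ u v → canForce G S u v ≡ false
stalled⇒cannotForce {n} G S stalled u v = ¬-not cannot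
  where
  only-v : Fin n → Bool
  only-v w = not (Adj G u w) ∨ lookup S w ∨ ⌊ w ≟ v ⌋
  is-v : all only-v (allFin n) ≡ true → ∀ w → Adj G u w ≡ true → lookup S w ≡ false → w ≡ v
  is-v only w uw w∉S with all-true only-v (allFin n) only (∈-allFin w)
  ... | condition rewrite uw | w∉S = dec-true (w ≟ v) condition
  cannot : canForce G S u v ≢ true
  cannot force = distinct (trans (is-v only w₁ adjacent₁ uncolored₁) (sym (is-v only w₂ adjacent₂ uncolored₂)))
    where
    open Blocked (stalled u (∧-conicalˡ _ _ force))
    only : all only-v (allFin n) ≡ true
    only = ∧-conicalʳ (Adj G u v) _ (∧-conicalʳ (not (lookup S v)) _ (∧-conicalʳ (lookup S u) _ force))

iterate-fixed : ∀ {A : Set} k (f : A → A) a → f a ≡ a → iterate k f a ≡ a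
iterate-fixed zero    f a fixed = refl
iterate-fixed (suc k) f a fixed rewrite fixed = iterate-fixed k f a fixed

-- A stalled set is its own closure, so it is not zero forcing as soon as
-- some vertex is uncolored.
stalled⇒notZF : ∀ {n} (G : Graph n) (S : Subset n) → Stalled G S →
  ∀ v → lookup S v ≡ false → isZeroForcingSet G S ≡ false
stalled⇒notZF {n} G S stalled v v∉S = ¬-not λ zf →
  true≢false (trans (sym (all-true (lookup (closure G S)) (allFin n) zf (∈-allFin v)))
                    (trans (cong (λ X → lookup X v) closure≡S) v∉S))
  where
  fixed : forceStep G S ≡ S
  fixed = trans (tabulate-cong λ v →
                  trans (cong (lookup S v ∨_) (any-none _ (λ u → stalled⇒cannotForce G S stalled u v) (allFin n)))
                        (∨-identityʳ _))
                (tabulate∘lookup S)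
  closure≡S : closure G S ≡ S
  closure≡S = iterate-fixed n (forceStep G) S fixed

-- An injective map Fin n → Fin n is onto: were v missed, punching v out of
-- its values would inject Fin n into Fin (n - 1).
injective⇒onto : ∀ {n} (σ : Fin n → Fin n) → Injective _≡_ _≡_ σ → ∀ v → Σ (Fin n) λ k → σ k ≡ v
injective⇒onto {suc m} σ σ-inj v with any? (λ k → σ k ≟ v)
... | yes hit  = hit
... | no  miss = ⊥-elim (1+n≰n (injective⇒≤ squeezed-inj))
  where
  image≢v : ∀ k → v ≢ σ k
  image≢v k e = miss (k , sym e)
  squeezed-inj : Injective _≡_ _≡_ (λ k → punchOut (image≢v k))
  squeezed-inj e = σ-inj (punchOut-injective (image≢v _) (image≢v _) e)

relabel : ∀ {n} → (Fin n → Fin n) → Subset n → Subset n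
relabel σ S = tabulate (lookup S ∘ σ)

lookup-relabel : ∀ {n} (σ : Fin n → Fin n) (S : Subset n) k → lookup (relabel σ S) k ≡ lookup S (σ k)
lookup-relabel σ S k = lookup∘tabulate (lookup S ∘ σ) k

relabel-id : ∀ {n} (S : Subset n) → relabel (λ k → k) S ≡ S
relabel-id S = tabulate∘lookup S

relabel-inverse : ∀ {n} (σ τ : Fin n → Fin n) → (∀ k → τ (σ k) ≡ k) →
                  ∀ S → relabel σ (relabel τ S) ≡ S
relabel-inverse σ τ τσ S =
  trans (tabulate-cong λ k → trans (lookup-relabel τ S (σ k)) (cong (lookup S) (τσ k)))
        (tabulate∘lookup S)

card≡count : ∀ {n} (S : Subset n) → card S ≡ count (lookup S) (allFin n)
card≡count S = along S (λ k → k) (λ k → refl)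
  where
  along : ∀ {n} (S : Subset n) {A : Set} {p : A → Bool} (g : Fin n → A) →
          (∀ k → p (g k) ≡ lookup S k) → card S ≡ count p (List.tabulate g)
  along [] g _ = refl
  along (b ∷ S) {p = p} g agree with p (g Fin.zero) | agree Fin.zero
  ... | true  | refl = cong suc (along S (g ∘ Fin.suc) (agree ∘ Fin.suc))
  ... | false | refl = along S (g ∘ Fin.suc) (agree ∘ Fin.suc)

-- Relabelling by a bijection preserves size: both directions are injections
-- between the members.
card-relabel : ∀ {n} (σ τ : Fin n → Fin n) → Injective _≡_ _≡_ σ → (∀ v → σ (τ v) ≡ v) →
               ∀ S → card (relabel σ S) ≡ card S
card-relabel {n} σ τ σ-inj στ S rewrite card≡count (relabel σ S) | card≡count S = ≤-antisym
  (count-injection _≟_ (allFin n) (allFin n) (Unique.allFin⁺ n) ∈-allFin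
     (lookup (relabel σ S)) (lookup S) σ σ-inj (λ k e → trans (sym (lookup-relabel σ S k)) e))
  (count-injection _≟_ (allFin n) (allFin n) (Unique.allFin⁺ n) ∈-allFin
     (lookup S) (lookup (relabel σ S)) τ τ-inj
     (λ v e → trans (lookup-relabel σ S (τ v)) (trans (cong (lookup S) (στ v)) e)))
  where
  τ-inj : Injective _≡_ _≡_ τ
  τ-inj {x} {y} e = trans (sym (στ x)) (trans (cong σ e) (στ y))

module HamiltonianPath {n} (G : Graph n) (σ : Fin n → Fin n) (σ-inj : Injective _≡_ _≡_ σ)
  (consecutive-adjacent : ∀ i j → toℕ j ≡ suc (toℕ i) → Adj G (σ i) (σ j) ≡ true) where

  position : Fin n → Fin n
  position v = proj₁ (injective⇒onto σ σ-inj v)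

  σ∘position : ∀ v → σ (position v) ≡ v
  σ∘position v = proj₂ (injective⇒onto σ σ-inj v)

  position∘σ : ∀ k → position (σ k) ≡ k
  position∘σ k = σ-inj (σ∘position (σ k))

  position-inj : Injective _≡_ _≡_ position
  position-inj {x} {y} e = trans (sym (σ∘position x)) (trans (cong σ e) (σ∘position y))

  color-at : ∀ S j → lookup S (σ j) ≡ at (relabel σ S) (toℕ j)
  color-at S j = trans (sym (lookup-relabel σ S j)) (lookup≡at (relabel σ S) j)

  -- If S is isolated along the path, each colored vertex is blocked by its
  -- two path neighbours.
  isolated⇒stalled : ∀ S → isolated (relabel σ S) ≡ true → Stalled G S
  isolated⇒stalled S iso u u∈S = record
    { w₁ = σ before ; w₂ = σ after
    ; distinct   = λ e → <-irrefl (before≡after (σ-inj e)) (m<n⇒m<1+n (n<1+n prev))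
    ; adjacent₁  = subst (λ w → Adj G w (σ before) ≡ true) (σ∘position u)
                     (trans (symm G (σ k) (σ before))
                            (consecutive-adjacent before k (trans x≡1+prev (cong suc (sym toℕ-before)))))
    ; adjacent₂  = subst (λ w → Adj G w (σ after) ≡ true) (σ∘position u)
                     (consecutive-adjacent k after toℕ-after)
    ; uncolored₁ = trans (color-at S before) (trans (cong (at (relabel σ S)) toℕ-before) prev-free)
    ; uncolored₂ = trans (color-at S after) (trans (cong (at (relabel σ S)) toℕ-after) next-free)
    }
    where
    k = position u
    colored : at (relabel σ S) (toℕ k) ≡ true
    colored = trans (sym (color-at S k)) (trans (cong (lookup S) (σ∘position u)) u∈S)
    open Isolation (isolated-isolation (relabel σ S) (toℕ k) iso colored)
    prev<n : prev < n
    prev<n = <-trans (n<1+n prev) (subst (_< n) x≡1+prev (toℕ<n k))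
    before after : Fin n
    before = fromℕ< prev<n
    after  = fromℕ< 1+x<m
    toℕ-before : toℕ before ≡ prev
    toℕ-before = toℕ-fromℕ< prev<n
    toℕ-after : toℕ after ≡ suc (toℕ k)
    toℕ-after = toℕ-fromℕ< 1+x<m
    before≡after : before ≡ after → prev ≡ suc (suc prev)
    before≡after e = trans (sym toℕ-before) (trans (cong toℕ e) (trans toℕ-after (cong suc x≡1+prev)))

  -- Hence such an S is not zero forcing: its first vertex on the path is uncolored.
  isolated⇒notZF : ∀ S → isolated (relabel σ S) ≡ true → isZeroForcingSet G S ≡ false
  isolated⇒notZF S iso with isolated-firstFree (relabel σ S) iso
  ... | v , free = stalled⇒notZF G S (isolated⇒stalled S iso) (σ v) (trans (sym (lookup-relabel σ S v)) free)

  -- Relabelling along the inverse ordering maps isolated strings injectively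
  -- to sets of the same size that are isolated along σ.
  isolatedCount≤ : ∀ i → isolatedCount n i ≤ countSubsets (λ S → isolated (relabel σ S) ∧ (card S ≡ᵇ i))
  isolatedCount≤ i =
    count-injection (≡-dec _≟ᵇ_) (allSubsets n) (allSubsets n) (allSubsets-unique n) allSubsets-complete
      _ _ (relabel position) relabel-position-inj preserved
    where
    back : ∀ T → relabel σ (relabel position T) ≡ T
    back = relabel-inverse σ position position∘σ
    relabel-position-inj : Injective _≡_ _≡_ (relabel position)
    relabel-position-inj {x} {y} e = trans (sym (back x)) (trans (cong (relabel σ) e) (back y))
    preserved : ∀ T → (isolated T ∧ (card T ≡ᵇ i)) ≡ true →
                (isolated (relabel σ (relabel position T)) ∧ (card (relabel position T) ≡ᵇ i)) ≡ true
    preserved T e rewrite back T | card-relabel position σ position-inj position∘σ T = e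

Consecutive : ℕ → ℕ → Set
Consecutive x y = y ≡ suc x ⊎ x ≡ suc y

pathAdj⇒consecutive : ∀ {n} (u w : Fin n) → pathAdj u w ≡ true → Consecutive (toℕ u) (toℕ w)
pathAdj⇒consecutive u w adj with toℕ w ≡ᵇ suc (toℕ u) in right
... | true  = inj₁ (≡ᵇ⇒≡ _ _ (≡true⇒T right))
... | false = inj₂ (≡ᵇ⇒≡ _ _ (≡true⇒T adj))

path-consecutive : ∀ n (i j : Fin n) → toℕ j ≡ suc (toℕ i) → Adj (path n) i j ≡ true
path-consecutive n i j next = cong (_∨ (toℕ i ≡ᵇ suc (toℕ j))) (T⇒≡true (≡⇒≡ᵇ _ _ next))

path-force : ∀ {n} (S : Subset n) {x y} (x<n : x < n) (y<n : y < n) →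
  at S x ≡ true → Consecutive x y →
  (∀ w → w < n → Consecutive x w → w ≢ y → at S w ≡ true) →
  at (forceStep (path n) S) y ≡ true
path-force {n} S {x} {y} x<n y<n x∈S xy others =
  trans (at-fromℕ< (forceStep (path n) S) y<n) forced
  where
  u = fromℕ< x<n
  v = fromℕ< y<n
  adjacent : Consecutive x y → Adj (path n) u v ≡ true
  adjacent (inj₁ y≡1+x) = path-consecutive n u v
    (trans (toℕ-fromℕ< y<n) (trans y≡1+x (cong suc (sym (toℕ-fromℕ< x<n)))))
  adjacent (inj₂ x≡1+y) = trans (symm (path n) u v) (path-consecutive n v u
    (trans (toℕ-fromℕ< x<n) (trans x≡1+y (cong suc (sym (toℕ-fromℕ< y<n))))))
  other-colored : ∀ w → Adj (path n) u w ≡ true → w ≢ v → lookup S w ≡ true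
  other-colored w uw w≢v = trans (lookup≡at S w)
    (others (toℕ w) (toℕ<n w) (subst (λ x → Consecutive x (toℕ w)) (toℕ-fromℕ< x<n) (pathAdj⇒consecutive u w uw))
            (λ e → w≢v (toℕ-injective (trans e (sym (toℕ-fromℕ< y<n))))))
  forced : lookup (forceStep (path n) S) v ≡ true
  forced with lookup S v in v∈S
  ... | true  = forceStep-keeps (path n) S v v∈S
  ... | false = forceStep-forces (path n) S u v
                  (canForce-intro (path n) S u v (trans (sym (at-fromℕ< S x<n)) x∈S) v∈S (adjacent xy) other-colored)

-- A block of S: the positions a, a+1, …, a+d are colored.  It is active when
-- it has at least two vertices or touches an end of the path; an active
-- block keeps growing under forcing.
record Block {n} (S : Subset n) (a d : ℕ) : Set where
  field
    fits    : a + d < n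
    colored : ∀ x → a ≤ x → x ≤ a + d → at S x ≡ true
    active  : 0 < d ⊎ a ≡ 0 ⊎ suc (a + d) ≡ n

point-block : ∀ {n} (S : Subset n) x → at S x ≡ true → x ≡ 0 ⊎ suc x ≡ n → Block S x 0
point-block {n} S x colored end = record
  { fits    = subst (_< n) (sym (+-identityʳ x)) (at⇒< S x colored)
  ; colored = λ y lo hi → subst (λ z → at S z ≡ true) (≤-antisym lo (subst (y ≤_) (+-identityʳ x) hi)) colored
  ; active  = inj₂ (map₂ (trans (cong suc (+-identityʳ x))) end)
  }

pair-block : ∀ {n} (S : Subset n) x → at S x ≡ true → at S (suc x) ≡ true → Block S x 1
pair-block {n} S x colored colored′ = record
  { fits    = subst (_< n) (+-comm 1 x) (at⇒< S (suc x) colored′)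
  ; colored = λ y lo hi → pick y lo (subst (y ≤_) (+-comm x 1) hi)
  ; active  = inj₁ (s≤s z≤n)
  }
  where
  pick : ∀ y → x ≤ y → y ≤ suc x → at S y ≡ true
  pick y lo hi with m≤n⇒m<n∨m≡n hi
  ... | inj₁ y<1+x = subst (λ z → at S z ≡ true) (≤-antisym lo (s≤s⁻¹ y<1+x)) colored
  ... | inj₂ refl  = colored′

notIsolated⇒block : ∀ {m} (S : Subset (suc m)) → isolated S ≡ false → Σ ℕ λ a → Σ ℕ λ d → Block S a d
notIsolated⇒block S fail with isolated-failure S fail
... | inj₁ first                     = 0 , 0 , point-block S 0 first (inj₁ refl)
... | inj₂ (x , colored , inj₁ last) = x , 0 , point-block S x colored (inj₂ last)
... | inj₂ (x , colored , inj₂ next) = x , 1 , pair-block S x colored next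

below-top : ∀ a d w → 0 < d ⊎ a ≡ 0 → a + d ≡ suc w → a ≤ w
below-top a (suc d) w _           top = subst (a ≤_) (suc-injective (trans (sym (+-suc a d)) top)) (m≤m+n a d)
below-top a zero    w (inj₂ refl) _   = z≤n

above-bottom : ∀ {n} a d → suc (suc a + d) ≡ n → suc (suc a) < n → suc (suc a) ≤ suc a + d
above-bottom a zero    end above = ⊥-elim (<-irrefl (trans (cong (suc ∘ suc) (sym (+-identityʳ a))) end) above)
above-bottom a (suc d) _   _     = ≤-trans (s≤s (s≤s (m≤m+n a d))) (≤-reflexive (cong suc (sym (+-suc a d))))

module _ {n} {S : Subset n} where

  private
    S′ = forceStep (path n) S

  block-persists : ∀ {a d} → Block S a d → Block S′ a d
  block-persists b = record
    { fits = fits ; colored = λ x lo hi → forceStep-keeps-at (path n) S x (colored x lo hi) ; active = active }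
    where open Block b

  -- A block with room on the right gains the next position: the top vertex
  -- a+d forces it, because its lower neighbour (if any) lies in the block.
  grow-right : ∀ {a d} → Block S a d → suc (a + d) < n → Block S′ a (suc d)
  grow-right {a} {d} b room = record
    { fits    = subst (_< n) (sym (+-suc a d)) room
    ; colored = colored′
    ; active  = inj₁ (s≤s z≤n)
    }
    where
    open Block b
    lower-in-block : ∀ w → a + d ≡ suc w → a ≤ w
    lower-in-block w top with active
    ... | inj₁ 0<d        = below-top a d w (inj₁ 0<d) top
    ... | inj₂ (inj₁ a≡0) = below-top a d w (inj₂ a≡0) top
    ... | inj₂ (inj₂ end) = ⊥-elim (<-irrefl end room)
    others : ∀ w → w < n → Consecutive (a + d) w → w ≢ suc (a + d) → at S w ≡ true
    others w _ (inj₁ w≡top+1) w≢ = ⊥-elim (w≢ w≡top+1)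
    others w _ (inj₂ top≡1+w) _  = colored w (lower-in-block w top≡1+w) (≤-trans (n≤1+n w) (≤-reflexive (sym top≡1+w)))
    colored′ : ∀ x → a ≤ x → x ≤ a + suc d → at S′ x ≡ true
    colored′ x lo hi with m≤n⇒m<n∨m≡n (subst (x ≤_) (+-suc a d) hi)
    ... | inj₁ x≤a+d = forceStep-keeps-at (path n) S x (colored x lo (s≤s⁻¹ x≤a+d))
    ... | inj₂ refl  = path-force S fits room (colored (a + d) (m≤m+n a d) ≤-refl) (inj₁ refl) others

  -- A block reaching the right end of the path gains the position below it:
  -- its bottom vertex forces it, because its upper neighbour (if any) lies
  -- in the block.
  grow-left : ∀ {a d} → Block S (suc a) d → suc (suc a + d) ≡ n → Block S′ a (suc d)
  grow-left {a} {d} b end = record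
    { fits    = subst (_< n) (sym (+-suc a d)) fits
    ; colored = colored′
    ; active  = inj₁ (s≤s z≤n)
    }
    where
    open Block b
    bottom<n : suc a < n
    bottom<n = ≤-trans (s≤s (m≤m+n (suc a) d)) fits
    others : ∀ w → w < n → Consecutive (suc a) w → w ≢ a → at S w ≡ true
    others w w<n (inj₁ refl)        _   = colored w (n≤1+n _) (above-bottom a d end w<n)
    others w _   (inj₂ 1+a≡1+w) w≢a = ⊥-elim (w≢a (sym (suc-injective 1+a≡1+w)))
    colored′ : ∀ x → a ≤ x → x ≤ a + suc d → at S′ x ≡ true
    colored′ x lo hi with m≤n⇒m<n∨m≡n lo
    ... | inj₁ a<x = forceStep-keeps-at (path n) S x (colored x a<x (subst (x ≤_) (+-suc a d) hi))
    ... | inj₂ refl = path-force S bottom<n (<-trans (n<1+n a) bottom<n)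
                        (colored (suc a) ≤-refl (m≤m+n (suc a) d)) (inj₂ refl) others

  step : ∀ a d → Block S a d → Σ ℕ λ a′ → Σ ℕ λ d′ → Block S′ a′ d′ × (suc d ≤ d′ ⊎ suc d′ ≡ n)
  step a d b with m≤n⇒m<n∨m≡n (Block.fits b)
  step a       d b | inj₁ room = a , suc d , grow-right b room , inj₁ ≤-refl
  step zero    d b | inj₂ full = 0 , d , block-persists b , inj₂ full
  step (suc a) d b | inj₂ end  = a , suc d , grow-left b end , inj₁ ≤-refl

spread : ∀ {n} k {S : Subset n} {a d} → Block S a d → n ≤ k + suc d →
         ∀ x → x < n → at (iterate k (forceStep (path n)) S) x ≡ true
spread zero {a = a} {d} b n≤d+1 x x<n = colored x (≤-trans a≤0 z≤n) (≤-trans x≤d (m≤n+m d a))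
  where
  open Block b
  a≤0 : a ≤ 0
  a≤0 = +-cancelʳ-≤ d a 0 (s≤s⁻¹ (≤-trans fits n≤d+1))
  x≤d : x ≤ d
  x≤d = s≤s⁻¹ (≤-trans x<n n≤d+1)
spread (suc k) {d = d} b n≤ with step _ _ b
... | _ , d′ , b′ , inj₁ longer = spread k b′ (≤-trans n≤ (≤-trans (≤-reflexive (sym (+-suc k (suc d)))) (+-monoʳ-≤ k (s≤s longer))))
... | _ , d′ , b′ , inj₂ full   = spread k b′ (≤-trans (≤-reflexive (sym full)) (m≤n+m (suc d′) k))

block⇒ZF : ∀ {n} {S : Subset n} {a d} → Block S a d → isZeroForcingSet (path n) S ≡ true
block⇒ZF {n} {S} {d = d} b = all-intro (lookup (closure (path n) S)) (λ v →
  trans (lookup≡at (closure (path n) S) v) (spread n b (m≤m+n n (suc d)) (toℕ v) (toℕ<n v))) (allFin n)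

-- On the path, the zero forcing sets are exactly the non-isolated sets:
-- isolated sets are stalled along the identity ordering, the others contain
-- an active block.
path-ZF : ∀ {n} (S : Subset n) → isZeroForcingSet (path n) S ≡ not (isolated S)
path-ZF []             = refl
path-ZF {suc m} S with isolated S in iso
... | true  = HamiltonianPath.isolated⇒notZF (path (suc m)) (λ k → k) (λ e → e) (path-consecutive (suc m)) S
                (trans (cong isolated (relabel-id S)) iso)
... | false with notIsolated⇒block S iso
...   | _ , _ , b = block⇒ZF b

z-bound : ∀ {n} (G : Graph n) (bad : Subset n → Bool) →
  (∀ S → bad S ≡ true → isZeroForcingSet G S ≡ false) →
  ∀ i → z G i ≤ n C i ∸ countSubsets (λ S → bad S ∧ (card S ≡ᵇ i))
z-bound {n} G bad bad⇒notZF i = begin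
  z G i                                            ≤⟨ count-mono _ _ zf⇒good (allSubsets n) ⟩
  countSubsets (λ S → not (bad S) ∧ (card S ≡ᵇ i))  ≡⟨ countSubsets-complement bad i ⟩
  n C i ∸ countSubsets (λ S → bad S ∧ (card S ≡ᵇ i)) ∎
  where
  open ≤-Reasoning
  zf⇒good : ∀ S → (isZeroForcingSet G S ∧ (card S ≡ᵇ i)) ≡ true → (not (bad S) ∧ (card S ≡ᵇ i)) ≡ true
  zf⇒good S zf with bad S in is-bad
  ... | false = ∧-conicalʳ _ _ zf
  ... | true  = ⊥-elim (true≢false (trans (sym (∧-conicalˡ _ _ zf)) (bad⇒notZF S is-bad)))

z-exact : ∀ {n} (G : Graph n) (bad : Subset n → Bool) →
  (∀ S → isZeroForcingSet G S ≡ not (bad S)) →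
  ∀ i → z G i ≡ n C i ∸ countSubsets (λ S → bad S ∧ (card S ≡ᵇ i))
z-exact {n} G bad zf≡good i =
  trans (count-cong _ _ (λ S → cong (_∧ (card S ≡ᵇ i)) (zf≡good S)) (allSubsets n))
        (countSubsets-complement bad i)

-- Sets isolated along a Hamiltonian path are not zero forcing, and there
-- are at least C(n-i-1, i) of them of each size i.
hamiltonian-bound : ∀ n (G : Graph n) → HasHamiltonianPath G → ∀ i → 1 ≤ i → i ≤ n →
  z G i ≤ n C i ∸ ((n ∸ i ∸ 1) C i)
hamiltonian-bound zero    G _ i 1≤i i≤0 with () ← ≤-trans 1≤i i≤0
hamiltonian-bound (suc m) G (σ , σ-inj , consecutive-adjacent) i _ _ = begin
  z G i
    ≤⟨ z-bound G (isolated ∘ relabel σ) isolated⇒notZF i ⟩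
  suc m C i ∸ countSubsets (λ S → isolated (relabel σ S) ∧ (card S ≡ᵇ i))
    ≤⟨ ∸-monoʳ-≤ (suc m C i) (subst (_≤ countSubsets (λ S → isolated (relabel σ S) ∧ (card S ≡ᵇ i)))
                                     (isolatedCount≡ m i) (isolatedCount≤ i)) ⟩
  suc m C i ∸ ((suc m ∸ i ∸ 1) C i)
    ∎
  where
  open ≤-Reasoning
  open HamiltonianPath G σ σ-inj consecutive-adjacent

path-count : ∀ n i → 1 ≤ i → i ≤ n → z (path n) i ≡ n C i ∸ ((n ∸ i ∸ 1) C i)
path-count zero    i 1≤i i≤0 with () ← ≤-trans 1≤i i≤0
path-count (suc m) i _ _ =
  trans (z-exact (path (suc m)) isolated path-ZF i) (cong (suc m C i ∸_) (isolatedCount≡ m i))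

proposition5p7 :
    (∀ (n : ℕ) (G : Graph n) → HasHamiltonianPath G →
      ∀ (i : ℕ) → 1 ≤ i → i ≤ n →
        z G i ≤ (n C i) ∸ ((n ∸ i ∸ 1) C i))
    ×
    (∀ (n i : ℕ) → 1 ≤ i → i ≤ n →
        z (path n) i ≡ (n C i) ∸ ((n ∸ i ∸ 1) C i))
proposition5p7 = hamiltonian-bound , path-count
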